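{- For each $k\in\mathbb{N}$ and $r\in\mathbb{N}_+$, the function $\rho(f,w)=\{f(c):c\in w\}$ (where $f(c)=\{f(u):u\in c\}$), defined for $f\in\mathcal{F}_k$ and witnesses $w$ of $\mathsf{Chrom}_{\le r}[k]$ with $\bigcup_{c\in w}c\subseteq\mathrm{dom}(f)$, is a witness action for $\mathsf{Chrom}_{\le r}[k]$.
   Context: The core $\mathsf{Chrom}_{\le r}[k]$: witnesses are sets $w$ of at most $r$ nonempty pairwise disjoint subsets (cells) of $[k+1]$, with label set $\mathrm{Lbl}_k(w)=\bigcup_{c\in w}c$. $\mathtt{Leaf}=\{\emptyset\}$. $\mathtt{IntroVertex}_u(w)$: $\emptyset$ if $u\in\bigcup w$; otherwise all $(w\setminus\{p\})\cup\{p\cup\{u\}\}$ for $p\in w$, plus $w\cup\{\{u\}\}$ if $|w|<r$. $\mathtt{ForgetVertex}_u(w)=\{\{p\setminus\{u\}:p\in w\}\setminus\{\emptyset\}\}$ if $u\in\bigcup w$, else $\emptyset$. $\mathtt{IntroEdge}_{u,v}(w)=\{w\}$ if $u,v$ are not in a common cell of $w$, else $\emptyset$ ($u\ne v$). $\mathtt{Join}(w,w')=\{w\}$ if $w=w'$, else $\emptyset$. Every witness is final ($\mathtt{Final}\equiv1$). $\mathcal{F}_k$ is the set of injective functions $f:b\to[k+1]$ with $b\subseteq[k+1]$; $f^{ -1}$ denotes the inverse on the image $f(b)$; $f\circ g$ is the partial composition with domain $\{u\in\mathrm{dom}(g):g(u)\in\mathrm{dom}(f)\}$. A witness action for a DP-core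 level $\mathsf{D}[k]$ with witness set $\mathcal{W}_k$ and label sets $\mathrm{Lbl}_k$ is a partial function $\rho:\mathcal{F}_k\times\mathcal{W}_k\to\mathcal{W}_k$ defined exactly on pairs with $\mathrm{Lbl}_k(w)\subseteq\mathrm{dom}(f)$, extended pointwise to finite sets ($\rho(f,S)=\{\rho(f,w):w\in S\}$), such that whenever the expressions are defined: (1) $\mathtt{Final}(w)=1$ iff $\mathtt{Final}(\rho(f,w))=1$; (2) $\mathrm{Lbl}_k(\rho(f,w))=f(\mathrm{Lbl}_k(w))$; (3) $\rho(f^{ -1},\rho(f,w))=w$; (4) $\rho(f\circ f',w)=\rho(f,\rho(f',w))$; (5) if $\mathrm{dom}(f)\subseteq\mathrm{dom}(f')$ and $f'|_{\mathrm{dom}(f)}=f$, then $\rho(f',w)=\rho(f,w)$; (6) for $u\in\mathrm{dom}(f)$: $\rho(f,\mathtt{IntroVertex}_u(w))=\mathtt{IntroVertex}_{f(u)}(\rho(f,w))$ and $\rho(f,\mathtt{ForgetVertex}_u(w))=\mathtt{ForgetVertex}_{f(u)}(\rho(f,w))$; for distinct $u,v\in\mathrm{dom}(f)$: $\rho(f,\mathtt{IntroEdge}_{u,v}(w))=\mathtt{IntroEdge}_{f(u),f(v)}(\rho(f,w))$; for $w'$ with $\mathrm{Lbl}_k(w')\subseteq\mathrm{dom}(f)$: $\rho(f,\mathtt{Join}(w,w'))=\mathtt{Join}(\rho(f,w),\rho(f,w'))$ (transitions returning finite sets, on which $\rho$ acts pointwise). -}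

module Defs where

open import Data.Nat using (ℕ; suc; _≤_; _<ᵇ_)
open import Data.Bool using (Bool; true; false; if_then_else_; _∧_; not)
open import Data.Maybe using (Maybe; just; nothing; Is-just; _>>=_)
open import Data.Fin using (Fin; _≟_)
open import Data.Fin.Subset
  using (Subset; _∈_; _∪_; _∩_; _-_; ⋃; ⁅_⁆; Nonempty; Empty)
open import Data.Vec using (tabulate; lookup)
open import Data.List using (List; []; _∷_; [_]; map; _++_; length; allFin; filterᵇ)
open import Data.Bool.ListAction using (any; all)
open import Data.List.Membership.Propositional using () renaming (_∈_ to _∈ₗ_)
open import Data.List.Relation.Unary.All using (All)
open import Data.List.Relation.Unary.AllPairs using (AllPairs)
open import Data.Product using (Σ; _×_; ∃)
open import Data.Empty using (⊥)
open import Relation.Nullary using (¬_)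
open import Relation.Nullary.Decidable using (⌊_⌋)
open import Relation.Binary.PropositionalEquality using (_≡_)
open import Function.Bundles using (_⇔_)
import Data.Vec.Properties as VecP
import Data.Bool as B

-- Labels are [k+1] = Fin (suc k); we work with a general n = k+1.
-- Cells are subsets of [n] (Data.Fin.Subset: Vec Bool n, so equality of
-- cells is extensional set equality).  A witness of Chrom_{≤r} is a finite
-- set of cells, represented by a list of cells together with the
-- witness-validity predicate below; equality of witnesses is set equality.

Cell : ℕ → Set
Cell n = Subset n

Wit : ℕ → Set
Wit n = List (Cell n)

Disjoint : ∀ {n} → Cell n → Cell n → Set
Disjoint p q = Empty (p ∩ q)

-- w is a set of at most r nonempty pairwise disjoint subsets of [n].
-- (Nonempty + pairwise disjoint forces the list to be duplicate-free, so
-- its length is the cardinality of the set.)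
IsWitness : ∀ {n} → ℕ → Wit n → Set
IsWitness r w = All Nonempty w × AllPairs Disjoint w × length w ≤ r

Lbl : ∀ {n} → Wit n → Subset n
Lbl w = ⋃ w

Final : ∀ {n} → Wit n → Bool
Final _ = true

_≋_ : ∀ {n} → Wit n → Wit n → Set
w ≋ w' = ∀ c → (c ∈ₗ w) ⇔ (c ∈ₗ w')

_≋ˢ_ : ∀ {n} → List (Wit n) → List (Wit n) → Set
S ≋ˢ S' = (∀ x → x ∈ₗ S → ∃ λ y → y ∈ₗ S' × x ≋ y)
        × (∀ y → y ∈ₗ S' → ∃ λ x → x ∈ₗ S × x ≋ y)

Leaf : ∀ {n} → List (Wit n)
Leaf = [ [] ]

alterEach : ∀ {A : Set} → (A → A) → List A → List (List A)
alterEach g []       = []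
alterEach g (x ∷ xs) = (g x ∷ xs) ∷ map (x ∷_) (alterEach g xs)

IntroVertex : ∀ {n} → ℕ → Fin n → Wit n → List (Wit n)
IntroVertex r u w =
  if lookup (Lbl w) u then []
  else (alterEach (λ p → p ∪ ⁅ u ⁆) w
        ++ (if length w <ᵇ r then [ ⁅ u ⁆ ∷ w ] else []))

nonemptyᵇ : ∀ {n} → Cell n → Bool
nonemptyᵇ {n} p = any (lookup p) (allFin n)

ForgetVertex : ∀ {n} → Fin n → Wit n → List (Wit n)
ForgetVertex u w =
  if lookup (Lbl w) u then [ filterᵇ nonemptyᵇ (map (λ p → p - u) w) ]
  else []

IntroEdge : ∀ {n} → Fin n → Fin n → Wit n → List (Wit n)
IntroEdge u v w =
  if any (λ c → lookup c u ∧ lookup c v) w then [] else [ w ]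

_=ᶜ_ : ∀ {n} → Cell n → Cell n → Bool
c =ᶜ d = ⌊ VecP.≡-dec B._≟_ c d ⌋

⊆ᵇ : ∀ {n} → Wit n → Wit n → Bool
⊆ᵇ w w' = all (λ c → any (c =ᶜ_) w') w

Join : ∀ {n} → Wit n → Wit n → List (Wit n)
Join w w' = if ⊆ᵇ w w' ∧ ⊆ᵇ w' w then [ w ] else []

-- F_k: injective partial functions [n] ⇀ [n], as Fin n → Maybe (Fin n)
-- together with injectivity on the domain.

PFun : ℕ → Set
PFun n = Fin n → Maybe (Fin n)

InjectivePF : ∀ {n} → PFun n → Set
InjectivePF f = ∀ {u v y} → f u ≡ just y → f v ≡ just y → u ≡ v

dom : ∀ {n} → PFun n → Fin n → Set
dom f u = Is-just (f u)

_∘ₚ_ : ∀ {n} → PFun n → PFun n → PFun n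
(f ∘ₚ g) u = g u >>= f

_=ᵐ_ : ∀ {n} → Maybe (Fin n) → Fin n → Bool
just x  =ᵐ y = ⌊ x ≟ y ⌋
nothing =ᵐ y = false

private
  search : ∀ {n} → PFun n → Fin n → List (Fin n) → Maybe (Fin n)
  search f y []       = nothing
  search f y (u ∷ us) = if f u =ᵐ y then just u else search f y us

inv : ∀ {n} → PFun n → PFun n
inv {n} f y = search f y (allFin n)

imgCell : ∀ {n} → PFun n → Cell n → Cell n
imgCell {n} f c = tabulate (λ y → any (λ u → lookup c u ∧ (f u =ᵐ y)) (allFin n))

-- the action ρ(f,w) = { f(c) : c ∈ w }, meaningful when Lbl(w) ⊆ dom(f)
ρ : ∀ {n} → PFun n → Wit n → Wit n
ρ f w = map (imgCell f) w

Defined : ∀ {n} → PFun n → Wit n → Set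
Defined f w = ∀ {u} → u ∈ Lbl w → dom f u

ρˢ : ∀ {n} → PFun n → List (Wit n) → List (Wit n)
ρˢ f S = map (ρ f) S

-- ρ is a witness action for Chrom_{≤r}[k] (n = k+1); conditions (1)-(6)
-- are each required whenever all expressions involved are defined.

record IsWitnessAction (n r : ℕ) : Set where
  field
    closed : ∀ (f : PFun n) (w : Wit n) → InjectivePF f → IsWitness r w → Defined f w →
             IsWitness r (ρ f w)
    final : ∀ (f : PFun n) (w : Wit n) → InjectivePF f → IsWitness r w → Defined f w →
            (Final w ≡ true) ⇔ (Final (ρ f w) ≡ true)
    lbl : ∀ (f : PFun n) (w : Wit n) → InjectivePF f → IsWitness r w → Defined f w →
          Lbl (ρ f w) ≡ imgCell f (Lbl w)
    inverse : ∀ (f : PFun n) (w : Wit n) → InjectivePF f → IsWitness r w → Defined f w →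
              Defined (inv f) (ρ f w) → ρ (inv f) (ρ f w) ≋ w
    compose : ∀ (f f' : PFun n) (w : Wit n) → InjectivePF f → InjectivePF f' → IsWitness r w →
              Defined (f ∘ₚ f') w → Defined f' w → Defined f (ρ f' w) →
              ρ (f ∘ₚ f') w ≋ ρ f (ρ f' w)
    restrict : ∀ (f f' : PFun n) (w : Wit n) → InjectivePF f → InjectivePF f' → IsWitness r w →
               (∀ {u y} → f u ≡ just y → f' u ≡ just y) →
               Defined f' w → Defined f w → ρ f' w ≋ ρ f w
    introVertex : ∀ (f : PFun n) (w : Wit n) (u : Fin n) → InjectivePF f → IsWitness r w → dom f u →
                  Defined f w → All (Defined f) (IntroVertex r u w) →
                  ∀ {fu} → f u ≡ just fu →
                  ρˢ f (IntroVertex r u w) ≋ˢ IntroVertex r fu (ρ f w)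
    forgetVertex : ∀ (f : PFun n) (w : Wit n) (u : Fin n) → InjectivePF f → IsWitness r w → dom f u →
                   Defined f w → All (Defined f) (ForgetVertex u w) →
                   ∀ {fu} → f u ≡ just fu →
                   ρˢ f (ForgetVertex u w) ≋ˢ ForgetVertex fu (ρ f w)
    introEdge : ∀ (f : PFun n) (w : Wit n) (u v : Fin n) → InjectivePF f → IsWitness r w → ¬ (u ≡ v) →
                dom f u → dom f v →
                Defined f w → All (Defined f) (IntroEdge u v w) →
                ∀ {fu fv} → f u ≡ just fu → f v ≡ just fv →
                ρˢ f (IntroEdge u v w) ≋ˢ IntroEdge fu fv (ρ f w)
    join : ∀ (f : PFun n) (w w' : Wit n) → InjectivePF f → IsWitness r w → IsWitness r w' →
           Defined f w → Defined f w' → All (Defined f) (Join w w') →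
           ρˢ f (Join w w') ≋ˢ Join (ρ f w) (ρ f w')

{-# OPTIONS --safe #-}
-- Since f is injective, f(u) ∈ f(c) exactly when u ∈ c.  Hence taking images
-- commutes with every set operation the transitions perform (∪, ─, singletons,
-- ⋃) and preserves every Boolean test they make (membership of a label, two
-- labels sharing a cell, non-emptiness, equality of cells inside dom f).  So ρ
-- maps the output list of each transition onto the output list of the translated
-- transition literally, and the conditions hold as equalities of lists.
module Submission where

open import Defs
open import Data.Nat using (ℕ; suc; _≤_; _<ᵇ_)
open import Data.Bool using (true; false; T; if_then_else_; _∧_)
open import Data.Bool.Properties using (T-≡; T-∧; ⇔→≡)
open import Data.Bool.ListAction using (any; or; and)
import Data.Bool as Bool
open import Data.Maybe using (Maybe; just; nothing; Is-just; _>>=_)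
open import Data.Maybe.Properties using (just-injective)
import Data.Maybe.Relation.Unary.Any as Maybe
open import Data.Fin using (Fin)
open import Data.Fin.Subset using (Subset; _∈_; _∉_; _⊆_; _∪_; _─_; _-_; ⋃; ⁅_⁆; Nonempty; inside)
import Data.Fin.Subset as Subset
open import Data.Fin.Subset.Properties
  using (⊆-antisym; ∉⊥; ⊥⊆; x∈⁅x⁆; x∈⁅y⁆⇒x≡y; p⊆p∪q; q⊆p∪q; x∈p∪q⁺; x∈p∪q⁻; x∈p∩q⁺; x∈p∩q⁻; p─q⊆p; x∈p∧x∉q⇒x∈p─q)
open import Data.Vec using (_∷_; lookup)
import Data.Vec as Vec
open import Data.Vec.Properties using ([]=⇒lookup; lookup⇒[]=; lookup∘tabulate; ≡-dec)
open import Data.List using (List; []; _∷_; [_]; map; _++_; length; allFin; foldr; filterᵇ)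
open import Data.List.Properties
  using (map-++; length-map; map-∘; map-cong; map-cong-local; map-id-local; foldr-universal)
open import Data.List.Membership.Propositional using (lose) renaming (_∈_ to _∈ₗ_)
open import Data.List.Membership.Propositional.Properties using (∈-allFin)
open import Data.List.Relation.Unary.Any using (here; there; satisfied)
open import Data.List.Relation.Unary.Any.Properties using (any⁺; any⁻)
open import Data.List.Relation.Unary.All as All using (All)
import Data.List.Relation.Unary.All.Properties as All
import Data.List.Relation.Unary.AllPairs as AllPairs
import Data.List.Relation.Unary.AllPairs.Properties as AllPairs
open import Data.Product using (∃; _×_; _,_; proj₁; proj₂; uncurry)
open import Data.Sum using ([_,_]′) renaming (map to map⊎)
open import Data.Empty using (⊥-elim)
open import Relation.Nullary using (Dec)
open import Relation.Nullary.Decidable using (isYes; does; isYes≗does; does-⇔; toWitness; fromWitness)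
open import Relation.Binary.PropositionalEquality
  using (_≡_; refl; sym; trans; cong; cong₂; subst; module ≡-Reasoning)
open import Function using (_∘_)
open import Function.Bundles using (_⇔_; mk⇔; Equivalence)
import Function.Properties.Equivalence as ⇔

open Equivalence using (to; from)

private
  variable
    A B : Set
    n : ℕ

Is-just⇒≡just : {m : Maybe A} → Is-just m → ∃ λ y → m ≡ just y
Is-just⇒≡just (Maybe.just _) = _ , refl

>>=-≡just⁻ : ∀ (m : Maybe A) {g : A → Maybe B} {y} → (m >>= g) ≡ just y →
             ∃ λ x → m ≡ just x × g x ≡ just y
>>=-≡just⁻ (just x) eq = x , refl , eq

T-=ᵐ : {m : Maybe (Fin n)} {y : Fin n} → T (m =ᵐ y) ⇔ m ≡ just y
T-=ᵐ {m = just x}  = mk⇔ (cong just ∘ toWitness) (fromWitness ∘ just-injective)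
T-=ᵐ {m = nothing} = mk⇔ (λ ()) (λ ())

∈⇒T-lookup : {x : Fin n} {p : Subset n} → x ∈ p → T (lookup p x)
∈⇒T-lookup x∈p = from T-≡ ([]=⇒lookup x∈p)

T-lookup⇒∈ : {x : Fin n} {p : Subset n} → T (lookup p x) → x ∈ p
T-lookup⇒∈ t = lookup⇒[]= _ _ (to T-≡ t)

x∈p─q⇒x∉q : ∀ {x : Fin n} (p q : Subset n) → x ∈ p ─ q → x ∉ q
x∈p─q⇒x∉q (_ ∷ p) (inside ∷ q) ()                Vec.here
x∈p─q⇒x∉q (_ ∷ p) (_      ∷ q) (Vec.there x∈p─q) (Vec.there x∈q) = x∈p─q⇒x∉q p q x∈p─q x∈q

⊆⋃ : ∀ {p : Subset n} {ps} → p ∈ₗ ps → p ⊆ ⋃ ps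
⊆⋃ {ps = p ∷ ps} (here refl) = p⊆p∪q (⋃ ps)
⊆⋃ {ps = p ∷ ps} (there p∈ps) = q⊆p∪q p (⋃ ps) ∘ ⊆⋃ p∈ps

nonemptyᵇ⇔Nonempty : {p : Subset n} → nonemptyᵇ p ≡ true ⇔ Nonempty p
nonemptyᵇ⇔Nonempty {n} {p} =
  mk⇔ witness (λ (x , x∈p) → to T-≡ (any⁺ (lookup p) (lose (∈-allFin x) (∈⇒T-lookup x∈p))))
  where
  witness : nonemptyᵇ p ≡ true → Nonempty p
  witness test with x , t ← satisfied (any⁻ (lookup p) (allFin n) (from T-≡ test)) = x , T-lookup⇒∈ t

DefinedOn : PFun n → Subset n → Set
DefinedOn f c = ∀ {u} → u ∈ c → dom f u

∈-imgCell⁺ : ∀ (f : PFun n) {c u y} → u ∈ c → f u ≡ just y → y ∈ imgCell f c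
∈-imgCell⁺ {n} f {c} {u} {y} u∈c fu≡y =
  lookup⇒[]= y (imgCell f c) (trans (lookup∘tabulate _ y)
    (to T-≡ (any⁺ _ (lose (∈-allFin u) (from T-∧ (∈⇒T-lookup u∈c , from T-=ᵐ fu≡y))))))

∈-imgCell⁻ : ∀ (f : PFun n) c {y} → y ∈ imgCell f c → ∃ λ u → u ∈ c × f u ≡ just y
∈-imgCell⁻ {n} f c {y} y∈fc
  with u , t ← satisfied (any⁻ _ (allFin n) (from T-≡ (trans (sym (lookup∘tabulate _ y)) ([]=⇒lookup y∈fc))))
  = u , T-lookup⇒∈ (proj₁ (to T-∧ t)) , to T-=ᵐ (proj₂ (to T-∧ t))

∈-imgCell-at : ∀ {f : PFun n} → InjectivePF f → ∀ {c u y} → f u ≡ just y → y ∈ imgCell f c ⇔ u ∈ c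
∈-imgCell-at {f = f} inj {c} fu≡y = mk⇔ preimage (λ u∈c → ∈-imgCell⁺ f u∈c fu≡y)
  where
  preimage : _ ∈ imgCell f c → _ ∈ c
  preimage y∈fc with v , v∈c , fv≡y ← ∈-imgCell⁻ f c y∈fc = subst (_∈ c) (inj fv≡y fu≡y) v∈c

lookup-imgCell : ∀ {f : PFun n} → InjectivePF f → ∀ {u y} → f u ≡ just y → ∀ c →
                 lookup (imgCell f c) y ≡ lookup c u
lookup-imgCell {f = f} inj {u} {y} fu≡y c =
  ⇔→≡ (⇔.trans (⇔.sym (∈⇔lookup (imgCell f c))) (⇔.trans (∈-imgCell-at inj fu≡y) (∈⇔lookup c)))
  where
  ∈⇔lookup : ∀ (p : Subset n) {x} → x ∈ p ⇔ lookup p x ≡ true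
  ∈⇔lookup p = mk⇔ []=⇒lookup (lookup⇒[]= _ p)

imgCell-mono : ∀ (f : PFun n) {p q} → p ⊆ q → imgCell f p ⊆ imgCell f q
imgCell-mono f p⊆q y∈fp with u , u∈p , fu≡y ← ∈-imgCell⁻ f _ y∈fp = ∈-imgCell⁺ f (p⊆q u∈p) fu≡y

imgCell-⊥ : ∀ (f : PFun n) → imgCell f Subset.⊥ ≡ Subset.⊥
imgCell-⊥ f = ⊆-antisym (λ y∈f⊥ → ⊥-elim (∉⊥ (proj₁ (proj₂ (∈-imgCell⁻ f Subset.⊥ y∈f⊥))))) ⊥⊆

imgCell-∪ : ∀ (f : PFun n) p q → imgCell f (p ∪ q) ≡ imgCell f p ∪ imgCell f q
imgCell-∪ f p q = ⊆-antisym image⊆ ⊆image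
  where
  image⊆ : imgCell f (p ∪ q) ⊆ imgCell f p ∪ imgCell f q
  image⊆ y∈ with u , u∈p∪q , fu≡y ← ∈-imgCell⁻ f (p ∪ q) y∈ =
    x∈p∪q⁺ (map⊎ (λ u∈p → ∈-imgCell⁺ f u∈p fu≡y) (λ u∈q → ∈-imgCell⁺ f u∈q fu≡y) (x∈p∪q⁻ p q u∈p∪q))
  ⊆image : imgCell f p ∪ imgCell f q ⊆ imgCell f (p ∪ q)
  ⊆image y∈ = [ imgCell-mono f (p⊆p∪q {p = p} q) , imgCell-mono f (q⊆p∪q p q) ]′
                (x∈p∪q⁻ (imgCell f p) (imgCell f q) y∈)

imgCell-⋃ : ∀ (f : PFun n) ps → imgCell f (⋃ ps) ≡ ⋃ (map (imgCell f) ps)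
imgCell-⋃ f []       = imgCell-⊥ f
imgCell-⋃ f (p ∷ ps) = trans (imgCell-∪ f p (⋃ ps)) (cong (imgCell f p ∪_) (imgCell-⋃ f ps))

imgCell-⁅⁆ : ∀ (f : PFun n) {u y} → f u ≡ just y → imgCell f ⁅ u ⁆ ≡ ⁅ y ⁆
imgCell-⁅⁆ f {u} {y} fu≡y = ⊆-antisym image⊆ ⊆image
  where
  image⊆ : imgCell f ⁅ u ⁆ ⊆ ⁅ y ⁆
  image⊆ z∈ with v , v∈⁅u⁆ , fv≡z ← ∈-imgCell⁻ f ⁅ u ⁆ z∈ with refl ← x∈⁅y⁆⇒x≡y u v∈⁅u⁆ =
    subst (_∈ ⁅ y ⁆) (just-injective (trans (sym fu≡y) fv≡z)) (x∈⁅x⁆ y)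
  ⊆image : ⁅ y ⁆ ⊆ imgCell f ⁅ u ⁆
  ⊆image z∈ with refl ← x∈⁅y⁆⇒x≡y y z∈ = ∈-imgCell⁺ f (x∈⁅x⁆ u) fu≡y

imgCell-─ : ∀ {f : PFun n} → InjectivePF f → ∀ p q → imgCell f (p ─ q) ≡ imgCell f p ─ imgCell f q
imgCell-─ {f = f} inj p q = ⊆-antisym image⊆ ⊆image
  where
  image⊆ : imgCell f (p ─ q) ⊆ imgCell f p ─ imgCell f q
  image⊆ y∈ with u , u∈p─q , fu≡y ← ∈-imgCell⁻ f (p ─ q) y∈ =
    x∈p∧x∉q⇒x∈p─q (∈-imgCell⁺ f (p─q⊆p p q u∈p─q) fu≡y)
                  (x∈p─q⇒x∉q p q u∈p─q ∘ to (∈-imgCell-at inj fu≡y))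
  ⊆image : imgCell f p ─ imgCell f q ⊆ imgCell f (p ─ q)
  ⊆image y∈ with u , u∈p , fu≡y ← ∈-imgCell⁻ f p (p─q⊆p _ _ y∈) =
    ∈-imgCell⁺ f (x∈p∧x∉q⇒x∈p─q u∈p (x∈p─q⇒x∉q _ _ y∈ ∘ λ u∈q → ∈-imgCell⁺ f u∈q fu≡y)) fu≡y

imgCell-- : ∀ {f : PFun n} → InjectivePF f → ∀ {u y} → f u ≡ just y → ∀ p →
            imgCell f (p - u) ≡ imgCell f p - y
imgCell-- {f = f} inj fu≡y p = trans (imgCell-─ inj p _) (cong (imgCell f p ─_) (imgCell-⁅⁆ f fu≡y))

imgCell-∘ : ∀ (f g : PFun n) c → imgCell (f ∘ₚ g) c ≡ imgCell f (imgCell g c)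
imgCell-∘ f g c = ⊆-antisym image⊆ ⊆image
  where
  image⊆ : imgCell (f ∘ₚ g) c ⊆ imgCell f (imgCell g c)
  image⊆ z∈ with u , u∈c , fgu≡z ← ∈-imgCell⁻ (f ∘ₚ g) c z∈
             with v , gu≡v , fv≡z ← >>=-≡just⁻ (g u) fgu≡z =
    ∈-imgCell⁺ f (∈-imgCell⁺ g u∈c gu≡v) fv≡z
  ⊆image : imgCell f (imgCell g c) ⊆ imgCell (f ∘ₚ g) c
  ⊆image z∈ with v , v∈gc , fv≡z ← ∈-imgCell⁻ f (imgCell g c) z∈
             with u , u∈c , gu≡v ← ∈-imgCell⁻ g c v∈gc =
    ∈-imgCell⁺ (f ∘ₚ g) u∈c (trans (cong (_>>= f) gu≡v) fv≡z)

imgCell-extend : ∀ {f f' : PFun n} → (∀ {u y} → f u ≡ just y → f' u ≡ just y) →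
                 ∀ {c} → DefinedOn f c → imgCell f' c ≡ imgCell f c
imgCell-extend {f = f} {f'} f⊆f' {c} defined = ⊆-antisym image⊆ ⊆image
  where
  image⊆ : imgCell f' c ⊆ imgCell f c
  image⊆ y∈ with u , u∈c , f'u≡y ← ∈-imgCell⁻ f' c y∈
             with z , fu≡z ← Is-just⇒≡just (defined u∈c) =
    ∈-imgCell⁺ f u∈c (trans fu≡z (trans (sym (f⊆f' fu≡z)) f'u≡y))
  ⊆image : imgCell f c ⊆ imgCell f' c
  ⊆image y∈ with u , u∈c , fu≡y ← ∈-imgCell⁻ f c y∈ = ∈-imgCell⁺ f' u∈c (f⊆f' fu≡y)

firstPreimageIn : PFun n → Fin n → List (Fin n) → Maybe (Fin n)
firstPreimageIn f y = foldr (λ u r → if f u =ᵐ y then just u else r) nothing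

-- `inv` is a linear search that Defs keeps private; abstracting over `allFin n`
-- exposes it as a function of the searched list, which is then a fold.
inv≡firstPreimageIn : ∀ (f : PFun n) y → inv f y ≡ firstPreimageIn f y (allFin n)
inv≡firstPreimageIn {n} f y =
  trans unfold (foldr-universal search _ nothing refl (λ _ _ → refl) (allFin n))
  where
  search : List (Fin n) → Maybe (Fin n)
  search = _
  unfold : inv f y ≡ search (allFin n)
  unfold with allFin n
  ... | _ = refl

firstPreimageIn-sound : ∀ (f : PFun n) {y} us {x} → firstPreimageIn f y us ≡ just x → f x ≡ just y
firstPreimageIn-sound f {y} (u ∷ us) eq with f u =ᵐ y in fu=y
... | true  with refl ← eq = to T-=ᵐ (from T-≡ fu=y)
... | false = firstPreimageIn-sound f us eq

firstPreimageIn-complete : ∀ (f : PFun n) {x y us} → x ∈ₗ us → f x ≡ just y →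
                           ∃ λ x' → firstPreimageIn f y us ≡ just x'
firstPreimageIn-complete f {y = y} {u ∷ us} x∈us fx≡y with f u =ᵐ y in fu=y | x∈us
... | true  | _            = u , refl
... | false | there x∈us′ = firstPreimageIn-complete f x∈us′ fx≡y
... | false | here refl    with () ← trans (sym fu=y) (to T-≡ (from T-=ᵐ fx≡y))

inv-sound : ∀ (f : PFun n) {x y} → inv f y ≡ just x → f x ≡ just y
inv-sound {n} f {y = y} invy≡x =
  firstPreimageIn-sound f (allFin n) (trans (sym (inv≡firstPreimageIn f y)) invy≡x)

inv-complete : ∀ {f : PFun n} → InjectivePF f → ∀ {x y} → f x ≡ just y → inv f y ≡ just x
inv-complete {n} {f} inj {x} {y} fx≡y
  with x' , found ← firstPreimageIn-complete f (∈-allFin x) fx≡y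
  = trans (inv≡firstPreimageIn f y)
          (trans found (cong just (inj (firstPreimageIn-sound f (allFin n) found) fx≡y)))

imgCell-inv : ∀ {f : PFun n} → InjectivePF f → ∀ {c} → DefinedOn f c →
              imgCell (inv f) (imgCell f c) ≡ c
imgCell-inv {f = f} inj {c} defined = ⊆-antisym image⊆ ⊆image
  where
  image⊆ : imgCell (inv f) (imgCell f c) ⊆ c
  image⊆ x∈ with y , y∈fc , invy≡x ← ∈-imgCell⁻ (inv f) (imgCell f c) x∈ =
    to (∈-imgCell-at inj (inv-sound f invy≡x)) y∈fc
  ⊆image : c ⊆ imgCell (inv f) (imgCell f c)
  ⊆image x∈c with y , fx≡y ← Is-just⇒≡just (defined x∈c) =
    ∈-imgCell⁺ (inv f) (∈-imgCell⁺ f x∈c fx≡y) (inv-complete inj fx≡y)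

imgCell-injective : ∀ {f : PFun n} → InjectivePF f → ∀ {c d} → DefinedOn f c → DefinedOn f d →
                    imgCell f c ≡ imgCell f d → c ≡ d
imgCell-injective {f = f} inj {c} {d} c-defined d-defined fc≡fd = begin
  c                              ≡⟨ imgCell-inv inj c-defined ⟨
  imgCell (inv f) (imgCell f c)  ≡⟨ cong (imgCell (inv f)) fc≡fd ⟩
  imgCell (inv f) (imgCell f d)  ≡⟨ imgCell-inv inj d-defined ⟩
  d                              ∎
  where open ≡-Reasoning

Disjoint-imgCell : ∀ {f : PFun n} → InjectivePF f → ∀ {p q} → Disjoint p q →
                   Disjoint (imgCell f p) (imgCell f q)
Disjoint-imgCell {f = f} inj {p} {q} p∩q-empty (y , y∈fp∩fq)
  with y∈fp , y∈fq ← x∈p∩q⁻ (imgCell f p) (imgCell f q) y∈fp∩fq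
  with u , u∈p , fu≡y ← ∈-imgCell⁻ f p y∈fp
  = p∩q-empty (u , x∈p∩q⁺ (u∈p , to (∈-imgCell-at inj fu≡y) y∈fq))

Nonempty-imgCell⁺ : ∀ {f : PFun n} {c} → DefinedOn f c → Nonempty c → Nonempty (imgCell f c)
Nonempty-imgCell⁺ {f = f} defined (x , x∈c) with y , fx≡y ← Is-just⇒≡just (defined x∈c) =
  y , ∈-imgCell⁺ f x∈c fx≡y

Nonempty-imgCell⁻ : ∀ (f : PFun n) c → Nonempty (imgCell f c) → Nonempty c
Nonempty-imgCell⁻ f c (y , y∈fc) with u , u∈c , _ ← ∈-imgCell⁻ f c y∈fc = u , u∈c

nonemptyᵇ-imgCell : ∀ {f : PFun n} c → DefinedOn f c → nonemptyᵇ (imgCell f c) ≡ nonemptyᵇ c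
nonemptyᵇ-imgCell {f = f} c defined =
  ⇔→≡ (⇔.trans nonemptyᵇ⇔Nonempty
         (⇔.trans (mk⇔ (Nonempty-imgCell⁻ f c) (Nonempty-imgCell⁺ defined)) (⇔.sym nonemptyᵇ⇔Nonempty)))

=ᶜ-imgCell : ∀ {f : PFun n} → InjectivePF f → ∀ {c d} → DefinedOn f c → DefinedOn f d →
             (imgCell f c =ᶜ imgCell f d) ≡ (c =ᶜ d)
=ᶜ-imgCell {n} {f} inj {c} {d} c-defined d-defined = begin
  isYes (≟-cell (imgCell f c) (imgCell f d))  ≡⟨ isYes≗does _ ⟩
  does (≟-cell (imgCell f c) (imgCell f d))   ≡⟨ does-⇔ fc≡fd⇔c≡d (≟-cell _ _) (≟-cell c d) ⟩
  does (≟-cell c d)                           ≡⟨ isYes≗does _ ⟨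
  isYes (≟-cell c d)                          ∎
  where
  open ≡-Reasoning
  ≟-cell : (p q : Subset n) → Dec (p ≡ q)
  ≟-cell = ≡-dec Bool._≟_
  fc≡fd⇔c≡d : imgCell f c ≡ imgCell f d ⇔ c ≡ d
  fc≡fd⇔c≡d = mk⇔ (imgCell-injective inj c-defined d-defined) (cong (imgCell f))

Defined⇒All-DefinedOn : ∀ {f : PFun n} w → Defined f w → All (DefinedOn f) w
Defined⇒All-DefinedOn w defined = All.tabulate (λ c∈w → defined ∘ ⊆⋃ c∈w)

lookup-Lbl-ρ : ∀ {f : PFun n} → InjectivePF f → ∀ {u y} → f u ≡ just y → ∀ w →
               lookup (Lbl (ρ f w)) y ≡ lookup (Lbl w) u
lookup-Lbl-ρ {f = f} inj {y = y} fu≡y w =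
  trans (cong (λ p → lookup p y) (sym (imgCell-⋃ f w))) (lookup-imgCell inj fu≡y (⋃ w))

ρ-inv : ∀ {f : PFun n} → InjectivePF f → ∀ {w} → All (DefinedOn f) w → ρ (inv f) (ρ f w) ≡ w
ρ-inv inj {w} defined = trans (sym (map-∘ w)) (map-id-local (All.map (imgCell-inv inj) defined))

ρ-∘ : ∀ (f g : PFun n) w → ρ (f ∘ₚ g) w ≡ ρ f (ρ g w)
ρ-∘ f g w = trans (map-cong (imgCell-∘ f g) w) (map-∘ w)

ρ-extend : ∀ {f f' : PFun n} → (∀ {u y} → f u ≡ just y → f' u ≡ just y) →
           ∀ {w} → All (DefinedOn f) w → ρ f' w ≡ ρ f w
ρ-extend f⊆f' defined = map-cong-local (All.map (imgCell-extend f⊆f') defined)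

IsWitness-ρ : ∀ {r} {f : PFun n} → InjectivePF f → ∀ {w} → Defined f w → IsWitness r w →
              IsWitness r (ρ f w)
IsWitness-ρ {r = r} inj {w} defined (nonempty , disjoint , length≤r) =
  All.map⁺ (All.zipWith (uncurry Nonempty-imgCell⁺) (Defined⇒All-DefinedOn w defined , nonempty)) ,
  AllPairs.map⁺ (AllPairs.map (Disjoint-imgCell inj) disjoint) ,
  subst (_≤ r) (sym (length-map _ w)) length≤r

map-if : ∀ (g : A → B) {b b'} → b ≡ b' → ∀ {xs ys xs' ys'} → map g xs ≡ xs' → map g ys ≡ ys' →
         map g (if b then xs else ys) ≡ (if b' then xs' else ys')
map-if g {true}  refl eq _  = eq
map-if g {false} refl _  eq = eq

map-alterEach : ∀ {h g g' : A → A} → (∀ x → h (g x) ≡ g' (h x)) → ∀ xs →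
                map (map h) (alterEach g xs) ≡ alterEach g' (map h xs)
map-alterEach                  h∘g≗g'∘h []       = refl
map-alterEach {h = h} {g} {g'} h∘g≗g'∘h (x ∷ xs) = cong₂ _∷_ (cong (_∷ map h xs) (h∘g≗g'∘h x)) (begin
  map (map h) (map (x ∷_) (alterEach g xs))    ≡⟨ map-∘ (alterEach g xs) ⟨
  map ((h x ∷_) ∘ map h) (alterEach g xs)      ≡⟨ map-∘ (alterEach g xs) ⟩
  map (h x ∷_) (map (map h) (alterEach g xs))  ≡⟨ cong (map (h x ∷_)) (map-alterEach h∘g≗g'∘h xs) ⟩
  map (h x ∷_) (alterEach g' (map h xs))       ∎)
  where open ≡-Reasoning

map-filterᵇ : ∀ (h : A → B) {p q} {xs} → All (λ x → p x ≡ q (h x)) xs →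
              map h (filterᵇ p xs) ≡ filterᵇ q (map h xs)
map-filterᵇ h All.[] = refl
map-filterᵇ h {p} {q} {x ∷ xs} (px≡qhx All.∷ agree) with p x | q (h x) | px≡qhx
... | true  | true  | _ = cong (h x ∷_) (map-filterᵇ h agree)
... | false | false | _ = map-filterᵇ h agree

ρˢ-IntroVertex : ∀ r {f : PFun n} → InjectivePF f → ∀ {u y} → f u ≡ just y → ∀ w →
                 ρˢ f (IntroVertex r u w) ≡ IntroVertex r y (ρ f w)
ρˢ-IntroVertex {n} r {f} inj {u} {y} fu≡y w =
  map-if (ρ f) (sym (lookup-Lbl-ρ inj fu≡y w)) refl (begin
    ρˢ f (alterEach (_∪ ⁅ u ⁆) w ++ newCell)
      ≡⟨ map-++ (ρ f) (alterEach (_∪ ⁅ u ⁆) w) newCell ⟩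
    ρˢ f (alterEach (_∪ ⁅ u ⁆) w) ++ ρˢ f newCell
      ≡⟨ cong₂ _++_ (map-alterEach addU-equivariant w)
                    (map-if (ρ f) (cong (_<ᵇ r) (sym (length-map _ w)))
                            (cong (λ c → [ c ∷ ρ f w ]) (imgCell-⁅⁆ f fu≡y)) refl) ⟩
    alterEach (_∪ ⁅ y ⁆) (ρ f w) ++ (if length (ρ f w) <ᵇ r then [ ⁅ y ⁆ ∷ ρ f w ] else []) ∎)
  where
  open ≡-Reasoning
  newCell : List (Wit n)
  newCell = if length w <ᵇ r then [ ⁅ u ⁆ ∷ w ] else []
  addU-equivariant : ∀ p → imgCell f (p ∪ ⁅ u ⁆) ≡ imgCell f p ∪ ⁅ y ⁆
  addU-equivariant p = trans (imgCell-∪ f p ⁅ u ⁆) (cong (imgCell f p ∪_) (imgCell-⁅⁆ f fu≡y))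

ρˢ-ForgetVertex : ∀ {f : PFun n} → InjectivePF f → ∀ {u y} → f u ≡ just y → ∀ {w} → All (DefinedOn f) w →
                  ρˢ f (ForgetVertex u w) ≡ ForgetVertex y (ρ f w)
ρˢ-ForgetVertex {f = f} inj {u} {y} fu≡y {w} defined =
  map-if (ρ f) (sym (lookup-Lbl-ρ inj fu≡y w)) (cong [_] (begin
    ρ f (filterᵇ nonemptyᵇ (map (_- u) w))
      ≡⟨ map-filterᵇ (imgCell f) (All.map⁺ (All.map emptinessPreserved defined)) ⟩
    filterᵇ nonemptyᵇ (map (imgCell f) (map (_- u) w))
      ≡⟨ cong (filterᵇ nonemptyᵇ) (trans (sym (map-∘ w)) (trans (map-cong (imgCell-- inj fu≡y) w) (map-∘ w))) ⟩
    filterᵇ nonemptyᵇ (map (_- y) (ρ f w)) ∎)) refl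
  where
  open ≡-Reasoning
  emptinessPreserved : ∀ {c} → DefinedOn f c → nonemptyᵇ (c - u) ≡ nonemptyᵇ (imgCell f (c - u))
  emptinessPreserved {c} c-defined = sym (nonemptyᵇ-imgCell (c - u) (λ x∈c-u → c-defined (p─q⊆p c ⁅ u ⁆ x∈c-u)))

ρˢ-IntroEdge : ∀ {f : PFun n} → InjectivePF f → ∀ {u v y z} → f u ≡ just y → f v ≡ just z → ∀ w →
               ρˢ f (IntroEdge u v w) ≡ IntroEdge y z (ρ f w)
ρˢ-IntroEdge {f = f} inj {u} {v} {y} {z} fu≡y fv≡z w = map-if (ρ f) (sym sameCellTest) refl refl
  where
  sameCellTest : any (λ c → lookup c y ∧ lookup c z) (ρ f w) ≡ any (λ c → lookup c u ∧ lookup c v) w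
  sameCellTest = cong or (trans (sym (map-∘ w))
    (map-cong (λ c → cong₂ _∧_ (lookup-imgCell inj fu≡y c) (lookup-imgCell inj fv≡z c)) w))

⊆ᵇ-ρ : ∀ {f : PFun n} → InjectivePF f → ∀ {w w'} → All (DefinedOn f) w → All (DefinedOn f) w' →
       ⊆ᵇ (ρ f w) (ρ f w') ≡ ⊆ᵇ w w'
⊆ᵇ-ρ {f = f} inj {w} {w'} defined defined' =
  cong and (trans (sym (map-∘ w)) (map-cong-local (All.map memberTest defined)))
  where
  memberTest : ∀ {c} → DefinedOn f c → any (imgCell f c =ᶜ_) (ρ f w') ≡ any (c =ᶜ_) w'
  memberTest c-defined =
    cong or (trans (sym (map-∘ w')) (map-cong-local (All.map (=ᶜ-imgCell inj c-defined) defined')))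

ρˢ-Join : ∀ {f : PFun n} → InjectivePF f → ∀ {w w'} → All (DefinedOn f) w → All (DefinedOn f) w' →
          ρˢ f (Join w w') ≡ Join (ρ f w) (ρ f w')
ρˢ-Join {f = f} inj defined defined' =
  map-if (ρ f) (sym (cong₂ _∧_ (⊆ᵇ-ρ inj defined defined') (⊆ᵇ-ρ inj defined' defined))) refl refl

≡⇒≋ : ∀ {w w' : Wit n} → w ≡ w' → w ≋ w'
≡⇒≋ refl _ = ⇔.refl

≡⇒≋ˢ : ∀ {S S' : List (Wit n)} → S ≡ S' → S ≋ˢ S'
≡⇒≋ˢ refl = (λ w w∈S → w , w∈S , ≡⇒≋ refl) , (λ w w∈S → w , w∈S , ≡⇒≋ refl)

lemma7 : (k r : ℕ) → 1 ≤ r → IsWitnessAction (suc k) r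
lemma7 k r _ = record
  { closed       = λ f w inj isWit defined → IsWitness-ρ inj defined isWit
  ; final        = λ _ _ _ _ _ → ⇔.refl
  ; lbl          = λ f w _ _ _ → sym (imgCell-⋃ f w)
  ; inverse      = λ f w inj _ defined _ → ≡⇒≋ (ρ-inv inj (cells w defined))
  ; compose      = λ f f' w _ _ _ _ _ _ → ≡⇒≋ (ρ-∘ f f' w)
  ; restrict     = λ f f' w _ _ _ f⊆f' _ defined → ≡⇒≋ (ρ-extend f⊆f' (cells w defined))
  ; introVertex  = λ f w u inj _ _ _ _ fu≡y → ≡⇒≋ˢ (ρˢ-IntroVertex r inj fu≡y w)
  ; forgetVertex = λ f w u inj _ _ defined _ fu≡y → ≡⇒≋ˢ (ρˢ-ForgetVertex inj fu≡y (cells w defined))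
  ; introEdge    = λ f w u v inj _ _ _ _ _ _ fu≡y fv≡z → ≡⇒≋ˢ (ρˢ-IntroEdge inj fu≡y fv≡z w)
  ; join         = λ f w w' inj _ _ defined defined' _ →
                     ≡⇒≋ˢ (ρˢ-Join inj (cells w defined) (cells w' defined'))
  }
  where
  cells : ∀ {f : PFun (suc k)} w → Defined f w → All (DefinedOn f) w
  cells = Defined⇒All-DefinedOn
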